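{- With the notation of the context (Algorithm 1 applied to $s$), for every integer $k$ with $3\le k\le m$: (i) if $z_{k+1,k-1}>a_{k-1}$, then $z_{k+1,k}<a_k$; (ii) if $z_{k+1,k-1}=a_{k-1}$ and $z_{k+1,k-2}>0$, then $z_{k+1,k}<a_k$.
   Context: Let $a$ be a real number with infinite continued fraction expansion $[a_0;a_1,a_2,\dots]$ ($a_0\in\mathbb{Z}$, $a_i$ positive integers for $i\ge1$). Set $q_{ -1}=0$, $q_0=1$, $q_{k+1}=a_{k+1}q_k+q_{k-1}$. The Ostrowski representation of $N\in\mathbb{N}$ is the unique word $b_n\dots b_1$ with $N=\sum_{k=0}^{n}b_{k+1}q_k$, $b_k\in\mathbb{N}$, $b_1<a_1$, $b_k\le a_k$, and $b_{k-1}=0$ whenever $b_k=a_k$. A word is written $u_r\dots u_1$; $u_i$ is the entry at position $i$. Let $M,N\in\mathbb{N}$ have Ostrowski representations $x_n\dots x_1$ and $y_n\dots y_1$ (padded with leading zeros to a common length $n$). Let $m=n+1$, $s_i=x_i+y_i$ for $1\le i\le n$, $s_m=0$, and $s=s_m\dots s_1$. Algorithm 1 defines words $z_k=z_{k,m}\dots z_{k,1}$ for $k=m+1,m,\dots,3$ recursively (in decreasing $k$). Put $z_{m+1}=s$. For $4\le k\le m$: $z_{k,i}=z_{k+1,i}$ for $i\notin\{k,k-1,k-2,k-3\}$, and (A1) if $z_{k+1,k}<a_k$, $z_{k+1,k-1}>a_{k-1}$ and $z_{k+1,k-2}=0$, then $(z_{k,k},z_{k,k-1},z_{k,k-2},z_{k,k-3})=(z_{k+1,k}+1,\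 z_{k+1,k-1}-(a_{k-1}+1),\ a_{k-2}-1,\ z_{k+1,k-3}+1)$; (A2) if $z_{k+1,k}<a_k$, $a_{k-1}\le z_{k+1,k-1}\le 2a_{k-1}$ and $z_{k+1,k-2}>0$, then $(z_{k,k},z_{k,k-1},z_{k,k-2},z_{k,k-3})=(z_{k+1,k}+1,\ z_{k+1,k-1}-a_{k-1},\ z_{k+1,k-2}-1,\ z_{k+1,k-3})$; (A3) otherwise these four entries are unchanged from $z_{k+1}$. For $k=3$: $z_{3,i}=z_{4,i}$ for $i\notin\{1,2,3\}$, and (B1) if $z_{4,3}<a_3$, $z_{4,2}>a_2$, $z_{4,1}=0$: $(z_{3,3},z_{3,2},z_{3,1})=(z_{4,3}+1,\ z_{4,2}-(a_2+1),\ a_1-1)$; (B2) if $z_{4,3}<a_3$, $z_{4,2}\ge a_2$, $a_1\ge z_{4,1}>0$: $(z_{4,3}+1,\ z_{4,2}-a_2,\ z_{4,1}-1)$; (B3) if $z_{4,3}<a_3$, $z_{4,2}\ge a_2$, $z_{4,1}>a_1$: $(z_{4,3}+1,\ z_{4,2}-a_2+1,\ z_{4,1}-a_1-1)$; (B4) if $z_{4,2}<a_2$, $z_{4,1}\ge a_1$: $(z_{4,3},\ z_{4,2}+1,\ z_{4,1}-a_1)$; (B5) otherwise unchanged. -}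

module Defs where

open import Data.Nat
open import Data.Bool using (Bool; true; false; if_then_else_; _∧_)
open import Data.Product using (_×_)
open import Relation.Binary.PropositionalEquality using (_≡_)

-- A word u_r … u_1 is represented as a function: position i ↦ entry u_i
-- (positions start at 1; entries at other positions are irrelevant / zero).
Word : Set
Word = ℕ → ℕ

-- Partial quotients: a i = a_i for i ≥ 1 (a 0 is unused; a_0 plays no role).
-- qq k = q_{k-1}, so qq 0 = q_{-1} = 0, qq 1 = q_0 = 1,
-- qq (k+2) = q_{k+1} = a_{k+1} q_k + q_{k-1}.
qq : (ℕ → ℕ) → ℕ → ℕ
qq a zero = 0
qq a (suc zero) = 1
qq a (suc (suc k)) = a (suc k) * qq a (suc k) + qq a k

-- value of the word b_n … b_1 : Σ_{k=0}^{n-1} b_{k+1} q_k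
ostVal : (ℕ → ℕ) → ℕ → Word → ℕ
ostVal a zero b = 0
ostVal a (suc n) b = ostVal a n b + b (suc n) * qq a (suc n)

IsOstrowskiRep : (ℕ → ℕ) → ℕ → ℕ → Word → Set
IsOstrowskiRep a N n b =
  (ostVal a n b ≡ N)
  × ((1 ≤ n → b 1 < a 1)
  × ((∀ k → 1 ≤ k → k ≤ n → b k ≤ a k)
  × (∀ k → 2 ≤ k → k ≤ n → b k ≡ a k → b (k ∸ 1) ≡ 0)))

-- s = s_m … s_1 with m = n+1, s_i = x_i + y_i (1 ≤ i ≤ n), s_m = 0
sWord : ℕ → Word → Word → Word
sWord n x y i = if (1 ≤ᵇ i) ∧ (i ≤ᵇ n) then x i + y i else 0

upd : Word → ℕ → ℕ → Word
upd w j v i = if i ≡ᵇ j then v else w i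

-- step for 4 ≤ k ≤ m: computes z_k from w = z_{k+1}
stepA : (ℕ → ℕ) → ℕ → Word → Word
stepA a k w =
  if (w k <ᵇ a k) ∧ (a (k ∸ 1) <ᵇ w (k ∸ 1)) ∧ (w (k ∸ 2) ≡ᵇ 0)
  then upd (upd (upd (upd w k (w k + 1))
                          (k ∸ 1) (w (k ∸ 1) ∸ (a (k ∸ 1) + 1)))
                          (k ∸ 2) (a (k ∸ 2) ∸ 1))
                          (k ∸ 3) (w (k ∸ 3) + 1)
  else if (w k <ᵇ a k) ∧ (a (k ∸ 1) ≤ᵇ w (k ∸ 1)) ∧ (w (k ∸ 1) ≤ᵇ 2 * a (k ∸ 1))
            ∧ (0 <ᵇ w (k ∸ 2))
  then upd (upd (upd w k (w k + 1))
                     (k ∸ 1) (w (k ∸ 1) ∸ a (k ∸ 1)))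
                     (k ∸ 2) (w (k ∸ 2) ∸ 1)
  else w

-- step for k = 3: computes z_3 from w = z_4
stepB : (ℕ → ℕ) → Word → Word
stepB a w =
  if (w 3 <ᵇ a 3) ∧ (a 2 <ᵇ w 2) ∧ (w 1 ≡ᵇ 0)
  then upd (upd (upd w 3 (w 3 + 1)) 2 (w 2 ∸ (a 2 + 1))) 1 (a 1 ∸ 1)
  else if (w 3 <ᵇ a 3) ∧ (a 2 ≤ᵇ w 2) ∧ (w 1 ≤ᵇ a 1) ∧ (0 <ᵇ w 1)
  then upd (upd (upd w 3 (w 3 + 1)) 2 (w 2 ∸ a 2)) 1 (w 1 ∸ 1)
  else if (w 3 <ᵇ a 3) ∧ (a 2 ≤ᵇ w 2) ∧ (a 1 <ᵇ w 1)
  then upd (upd (upd w 3 (w 3 + 1)) 2 (w 2 ∸ a 2 + 1)) 1 (w 1 ∸ a 1 ∸ 1)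
  else if (w 2 <ᵇ a 2) ∧ (a 1 ≤ᵇ w 1)
  then upd (upd w 2 (w 2 + 1)) 1 (w 1 ∸ a 1)
  else w

step : (ℕ → ℕ) → ℕ → Word → Word
step a k w = if k ≡ᵇ 3 then stepB a w else stepA a k w

-- zIter a m s j = z_{m+1-j}  (j steps of Algorithm 1 performed on s)
zIter : (ℕ → ℕ) → ℕ → Word → ℕ → Word
zIter a m s zero = s
zIter a m s (suc j) = step a (m ∸ j) (zIter a m s j)

-- z a n x y k = z_k for 3 ≤ k ≤ m+1, where m = n+1 and s = sWord n x y
z : (ℕ → ℕ) → ℕ → Word → Word → ℕ → Word
z a n x y k = zIter a (suc n) (sWord n x y) (suc (suc n) ∸ k)

module Submission where

open import Defs
open import Data.Nat using (ℕ; suc; _∸_; _≤_; _<_)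
open import Data.Product using (_×_)
open import Relation.Binary.PropositionalEquality using (_≡_)

open import Data.Nat using (zero; _+_; _*_; z≤n; s≤s; s≤s⁻¹)
open import Data.Nat.Properties
open import Data.Bool using (if_then_else_)
open import Data.Empty using (⊥-elim)
open import Data.Sum using (_⊎_; inj₁; inj₂)
open import Data.Product using (_,_; proj₁; proj₂)
open import Relation.Nullary using (Dec; does; yes; no; ¬_)
open import Relation.Nullary.Decidable using (_×-dec_; dec-true; dec-false)
open import Relation.Binary.PropositionalEquality using (refl; sym; trans; cong; subst; subst₂; _≢_)

-- Write k = t + 3 and let w = z_{k+1}.  We show by downward
-- induction on k (i.e. along the run of Algorithm 1) the invariant
--   (top)    w_k ≤ a_k, and w_k = a_k only if w_{k-1} < a_{k-1};
--   (middle) w_{k-1} ≤ 2a_{k-1} + 1, with w_{k-2} = 0 when w_{k-1} = 2a_{k-1}+1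
--            and w_{k-2} ≤ a_{k-2} when w_{k-1} = 2a_{k-1};
--   (low)    w_{k-2} is s_{k-2} or s_{k-2} + 1, and w_i = s_i for i < k-2.
-- Both parts of the theorem follow from (top): if w_{k-1} ≥ a_{k-1} then w_k < a_k.
-- The invariant holds for z_{m+1} = s because s_m = 0 and the digits of s are sums
-- of two Ostrowski digits (lemma digit-pair-sum).  It is preserved by each step
-- k+1 ↦ k (4 ≤ k+1 ≤ m) of the algorithm: we show separately that rules (A1),
-- (A2) and the idle rule (A3) each preserve it, the latter using that (A1) and
-- (A2) failing forces the bounds in (top).

if-yes : ∀ {A P : Set} (p? : Dec P) {x y : A} → P → (if does p? then x else y) ≡ x
if-yes p? p rewrite dec-true p? p = refl

if-no : ∀ {A P : Set} (p? : Dec P) {x y : A} → ¬ P → (if does p? then x else y) ≡ y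
if-no p? ¬p rewrite dec-false p? ¬p = refl

upd-same : ∀ w j v → upd w j v j ≡ v
upd-same w j v = if-yes (j ≟ j) refl

upd-other : ∀ w j v {i} → i ≢ j → upd w j v i ≡ w i
upd-other w j v {i} i≢j = if-no (i ≟ j) i≢j

upd-below : ∀ w j v {i} → i < j → upd w j v i ≡ w i
upd-below w j v i<j = upd-other w j v (<⇒≢ i<j)

upd-above : ∀ w j v {i} → j < i → upd w j v i ≡ w i
upd-above w j v j<i = upd-other w j v (>⇒≢ j<i)

-- A digit u of a sum of two Ostrowski representations, with the digit v just
-- below it; A, A' are the partial quotients at the two positions.
record DigitSum (A A' u v : ℕ) : Set where
  field
    bound          : u ≤ A + A
    full⇒zero      : u ≡ A + A → v ≡ 0
    nearFull⇒small : suc u ≡ A + A → v ≤ A'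

-- The same after u may have received a carry of one.
record CarriedDigit (A A' u v : ℕ) : Set where
  field
    bound          : u ≤ suc (A + A)
    over⇒zero      : u ≡ suc (A + A) → v ≡ 0
    full⇒small     : u ≡ A + A → v ≤ A'

-- Adding two Ostrowski digit pairs (u, v) and (u', v') gives a DigitSum:
-- the sum can only be 2A or 2A - 1 if one of the upper digits is full, and a
-- full upper digit forces a zero lower digit.
digit-pair-sum : ∀ {A A' u u' v v'} → u ≤ A → u' ≤ A →
  (u ≡ A → v ≡ 0) → (u' ≡ A → v' ≡ 0) → v ≤ A' → v' ≤ A' →
  DigitSum A A' (u + u') (v + v')
digit-pair-sum {A} {A'} {u} {u'} {v} {v'} u≤A u'≤A uv u'v' v≤A' v'≤A' = record
  { bound = +-mono-≤ u≤A u'≤A ; full⇒zero = full ; nearFull⇒small = nearFull }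
  where
  full : u + u' ≡ A + A → v + v' ≡ 0
  full e with m≤n⇒m<n∨m≡n u≤A | m≤n⇒m<n∨m≡n u'≤A
  ... | inj₁ u<A | _        = ⊥-elim (<-irrefl e (+-mono-<-≤ u<A u'≤A))
  ... | inj₂ _   | inj₁ u'<A = ⊥-elim (<-irrefl e (+-mono-≤-< u≤A u'<A))
  ... | inj₂ u≡A | inj₂ u'≡A = trans (cong (_+ v') (uv u≡A)) (u'v' u'≡A)
  nearFull : suc (u + u') ≡ A + A → v + v' ≤ A'
  nearFull e with m≤n⇒m<n∨m≡n u≤A | m≤n⇒m<n∨m≡n u'≤A
  ... | inj₂ u≡A | _         = subst (λ c → c + v' ≤ A') (sym (uv u≡A)) v'≤A'
  ... | inj₁ _   | inj₂ u'≡A = subst (λ c → v + c ≤ A') (sym (u'v' u'≡A))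
                                 (subst (_≤ A') (sym (+-identityʳ v)) v≤A')
  ... | inj₁ u<A | inj₁ u'<A =
    ⊥-elim (<-irrefl e (subst (_≤ A + A) (+-suc (suc u) u') (+-mono-≤ u<A u'<A)))

-- Above the length of the representations the sum digit is 0.
zero-digitSum : ∀ {A A' v} → 1 ≤ A → DigitSum A A' 0 v
zero-digitSum {suc A} _ = record
  { bound = z≤n ; full⇒zero = λ () ; nearFull⇒small = λ e → ⊥-elim (absurd A e) }
  where
  absurd : ∀ A → 1 ≢ suc (A + suc A)
  absurd A e = 0≢1+n (trans (suc-injective e) (+-suc A A))

carried : ∀ {A A' u u' v} → DigitSum A A' u v → u' ≡ u ⊎ u' ≡ suc u →
  CarriedDigit A A' u' v
carried {A} d (inj₁ refl) = record
  { bound = m≤n⇒m≤1+n bound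
  ; over⇒zero = λ e → ⊥-elim (<-irrefl e (s≤s bound))
  ; full⇒small = λ e → subst (_≤ _) (sym (full⇒zero e)) z≤n }
  where open DigitSum d
carried d (inj₂ refl) = record
  { bound = s≤s bound
  ; over⇒zero = λ e → full⇒zero (suc-injective e)
  ; full⇒small = nearFull⇒small }
  where open DigitSum d

small-carried : ∀ {A A' u v} → u < A → CarriedDigit A A' u v
small-carried {A} u<A = record
  { bound = m≤n⇒m≤1+n u≤2A
  ; over⇒zero = λ e → ⊥-elim (<-irrefl e (s≤s u≤2A))
  ; full⇒small = λ e → ⊥-elim (<-irrefl e (<-≤-trans u<A (m≤m+n A A))) }
  where
  u≤2A = ≤-trans (<⇒≤ u<A) (m≤m+n A A)

double : ∀ A → 2 * A ≡ A + A
double A = cong (A +_) (+-identityʳ A)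

pred-< : ∀ {u} → 0 < u → u ∸ 1 < u
pred-< {suc u} _ = ≤-refl

lowered : ∀ {A A' u v} → CarriedDigit A A' u v → 0 < u → CarriedDigit A A' (u ∸ 1) v
lowered {A} {A'} {suc u} {v} d _ = record
  { bound = m≤n⇒m≤1+n u≤2A
  ; over⇒zero = λ e → ⊥-elim (<-irrefl e (s≤s u≤2A))
  ; full⇒small = λ e → subst (_≤ A') (sym (over⇒zero (cong suc e))) z≤n }
  where
  open CarriedDigit d
  u≤2A : u ≤ A + A
  u≤2A = s≤s⁻¹ bound

A1-applies : (ℕ → ℕ) → ℕ → Word → Set
A1-applies a k w = w k < a k × a (k ∸ 1) < w (k ∸ 1) × w (k ∸ 2) ≡ 0

A2-applies : (ℕ → ℕ) → ℕ → Word → Set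
A2-applies a k w =
  w k < a k × a (k ∸ 1) ≤ w (k ∸ 1) × w (k ∸ 1) ≤ 2 * a (k ∸ 1) × 0 < w (k ∸ 2)

A1? : ∀ a k w → Dec (A1-applies a k w)
A1? a k w = w k <? a k ×-dec a (k ∸ 1) <? w (k ∸ 1) ×-dec w (k ∸ 2) ≟ 0

A2? : ∀ a k w → Dec (A2-applies a k w)
A2? a k w = w k <? a k ×-dec a (k ∸ 1) ≤? w (k ∸ 1) ×-dec w (k ∸ 1) ≤? 2 * a (k ∸ 1)
            ×-dec 0 <? w (k ∸ 2)

ruleA1 : (ℕ → ℕ) → ℕ → Word → Word
ruleA1 a k w = upd (upd (upd (upd w k (w k + 1))
                                (k ∸ 1) (w (k ∸ 1) ∸ (a (k ∸ 1) + 1)))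
                           (k ∸ 2) (a (k ∸ 2) ∸ 1))
                      (k ∸ 3) (w (k ∸ 3) + 1)

ruleA2 : (ℕ → ℕ) → ℕ → Word → Word
ruleA2 a k w = upd (upd (upd w k (w k + 1))
                           (k ∸ 1) (w (k ∸ 1) ∸ a (k ∸ 1)))
                      (k ∸ 2) (w (k ∸ 2) ∸ 1)

stepA-A1 : ∀ a k w → A1-applies a k w → stepA a k w ≡ ruleA1 a k w
stepA-A1 a k w r1 = if-yes (A1? a k w) r1

stepA-A2 : ∀ a k w → ¬ A1-applies a k w → A2-applies a k w → stepA a k w ≡ ruleA2 a k w
stepA-A2 a k w ¬r1 r2 = trans (if-no (A1? a k w) ¬r1) (if-yes (A2? a k w) r2)

stepA-idle : ∀ a k w → ¬ A1-applies a k w → ¬ A2-applies a k w → stepA a k w ≡ w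
stepA-idle a k w ¬r1 ¬r2 = trans (if-no (A1? a k w) ¬r1) (if-no (A2? a k w) ¬r2)

module RuleEntries (a : ℕ → ℕ) (j : ℕ) (w : Word) where
  private
    k = 3 + j
    A1₂ = w (2 + j) ∸ (a (2 + j) + 1)
    A1₁ = a (1 + j) ∸ 1
    A1₀ = w j + 1
    A2₂ = w (2 + j) ∸ a (2 + j)
    A2₁ = w (1 + j) ∸ 1
    W₃ = upd w k (w k + 1)
    A1W₂ = upd W₃ (2 + j) A1₂
    A1W₁ = upd A1W₂ (1 + j) A1₁
    A2W₂ = upd W₃ (2 + j) A2₂

  ruleA1-at-k-1 : ruleA1 a k w (2 + j) ≡ A1₂
  ruleA1-at-k-1 = trans (upd-above A1W₁ j A1₀ (m<n⇒m<1+n (n<1+n j)))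
                    (trans (upd-above A1W₂ (1 + j) A1₁ ≤-refl) (upd-same W₃ (2 + j) A1₂))

  ruleA1-at-k-2 : ruleA1 a k w (1 + j) ≡ A1₁
  ruleA1-at-k-2 = trans (upd-above A1W₁ j A1₀ ≤-refl) (upd-same A1W₂ (1 + j) A1₁)

  ruleA1-at-k-3 : ruleA1 a k w j ≡ A1₀
  ruleA1-at-k-3 = upd-same A1W₁ j A1₀

  ruleA1-low : ∀ {i} → i < j → ruleA1 a k w i ≡ w i
  ruleA1-low i<j =
    trans (upd-below A1W₁ j A1₀ i<j)
      (trans (upd-below A1W₂ (1 + j) A1₁ (m<n⇒m<1+n i<j))
        (trans (upd-below W₃ (2 + j) A1₂ (m<n⇒m<1+n (m<n⇒m<1+n i<j)))
               (upd-below w k (w k + 1) (m<n⇒m<1+n (m<n⇒m<1+n (m<n⇒m<1+n i<j))))))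

  ruleA2-at-k-1 : ruleA2 a k w (2 + j) ≡ A2₂
  ruleA2-at-k-1 = trans (upd-above A2W₂ (1 + j) A2₁ ≤-refl) (upd-same W₃ (2 + j) A2₂)

  ruleA2-at-k-2 : ruleA2 a k w (1 + j) ≡ A2₁
  ruleA2-at-k-2 = upd-same A2W₂ (1 + j) A2₁

  ruleA2-low : ∀ {i} → i < 1 + j → ruleA2 a k w i ≡ w i
  ruleA2-low i<j =
    trans (upd-below A2W₂ (1 + j) A2₁ i<j)
      (trans (upd-below W₃ (2 + j) A2₂ (m<n⇒m<1+n i<j))
             (upd-below w k (w k + 1) (m<n⇒m<1+n (m<n⇒m<1+n i<j))))

-- The invariant of the opening comment for w = z_{k+1}, k = t + 3.
record Invariant (a : ℕ → ℕ) (s : Word) (t : ℕ) (w : Word) : Set where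
  field
    top-bound : w (3 + t) ≤ a (3 + t)
    top-full  : w (3 + t) ≡ a (3 + t) → w (2 + t) < a (2 + t)
    middle    : CarriedDigit (a (2 + t)) (a (1 + t)) (w (2 + t)) (w (1 + t))
    low       : w (1 + t) ≡ s (1 + t) ⊎ w (1 + t) ≡ suc (s (1 + t))
    below     : ∀ i → i ≤ t → w i ≡ s i

  top-below : a (2 + t) ≤ w (2 + t) → w (3 + t) < a (3 + t)
  top-below a≤w with m≤n⇒m<n∨m≡n top-bound
  ... | inj₁ w<a  = w<a
  ... | inj₂ full = ⊥-elim (<⇒≱ (top-full full) a≤w)

-- One step k+1 ↦ k of the algorithm (k = t + 3) preserves the invariant,
-- given that the sum digits s_{k-1}, s_{k-2} form a DigitSum.
module Step (a : ℕ → ℕ) (apos : ∀ i → 1 ≤ i → 1 ≤ a i) (s : Word) (t : ℕ)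
            (sum : DigitSum (a (2 + t)) (a (1 + t)) (s (2 + t)) (s (1 + t)))
            (w : Word) (inv : Invariant a s (suc t) w) where
  open Invariant inv
  open RuleEntries a (suc t) w

  w-low : w (1 + t) ≡ s (1 + t)
  w-low = below (1 + t) ≤-refl

  -- The digit at k-1 of w, whose lower digit w_{k-2} is still that of s.
  middle′ : CarriedDigit (a (2 + t)) (a (1 + t)) (w (2 + t)) (w (1 + t))
  middle′ = subst (CarriedDigit _ _ _) (sym w-low) (carried sum low)

  idle-keeps : w (3 + t) ≤ a (3 + t) → (w (3 + t) ≡ a (3 + t) → w (2 + t) < a (2 + t)) →
    Invariant a s t w
  idle-keeps top≤ top≡ = record
    { top-bound = top≤ ; top-full = top≡ ; middle = middle′ ; low = inj₁ w-low
    ; below = λ i i≤t → below i (m≤n⇒m≤1+n i≤t) }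

  ruleA1-keeps : w (3 + t) ≤ suc (a (3 + t) + a (3 + t)) → Invariant a s t (ruleA1 a (4 + t) w)
  ruleA1-keeps w≤ = record
    { top-bound = subst (_≤ _) (sym ruleA1-at-k-1)
        (m≤n+o⇒m∸n≤o (w (3 + t)) (a (3 + t) + 1)
          (subst (w (3 + t) ≤_) (sym (+-suc-assoc (a (3 + t)))) w≤))
    ; top-full = λ _ → subst (_< _) (sym ruleA1-at-k-2) pred<
    ; middle = subst (λ c → CarriedDigit (a (2 + t)) (a (1 + t)) c (ruleA1 a (4 + t) w (1 + t)))
                 (sym ruleA1-at-k-2) (small-carried pred<)
    ; low = inj₂ (trans ruleA1-at-k-3 (trans (+-comm (w (1 + t)) 1) (cong suc w-low)))
    ; below = λ i i≤t → trans (ruleA1-low (s≤s i≤t)) (below i (m≤n⇒m≤1+n i≤t)) }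
    where
    pred< : a (2 + t) ∸ 1 < a (2 + t)
    pred< = pred-< (apos (2 + t) (s≤s z≤n))
    +-suc-assoc : ∀ A → A + 1 + A ≡ suc (A + A)
    +-suc-assoc A = trans (+-assoc A 1 A) (+-suc A A)

  ruleA2-keeps : a (3 + t) ≤ w (3 + t) → w (3 + t) ≤ a (3 + t) + a (3 + t) → 0 < w (2 + t) →
    Invariant a s t (ruleA2 a (4 + t) w)
  ruleA2-keeps a≤w w≤ v>0 = record
    { top-bound = subst (_≤ _) (sym ruleA2-at-k-1) (m≤n+o⇒m∸n≤o (w (3 + t)) (a (3 + t)) w≤)
    ; top-full = λ e → subst (_< _) (sym ruleA2-at-k-2)
        (pos-pred< (CarriedDigit.full⇒small middle (full (trans (sym ruleA2-at-k-1) e))))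
    ; middle = subst₂ (CarriedDigit (a (2 + t)) (a (1 + t))) (sym ruleA2-at-k-2)
                 (sym (ruleA2-low ≤-refl)) (lowered middle′ v>0)
    ; low = inj₁ (trans (ruleA2-low ≤-refl) w-low)
    ; below = λ i i≤t → trans (ruleA2-low (s≤s (m≤n⇒m≤1+n i≤t))) (below i (m≤n⇒m≤1+n i≤t)) }
    where
    full : w (3 + t) ∸ a (3 + t) ≡ a (3 + t) → w (3 + t) ≡ a (3 + t) + a (3 + t)
    full e = trans (sym (m∸n+n≡m a≤w)) (cong (_+ a (3 + t)) e)
    pos-pred< : w (2 + t) ≤ a (2 + t) → w (2 + t) ∸ 1 < a (2 + t)
    pos-pred< = <-≤-trans (pred-< v>0)

  idle-bounds : ¬ A1-applies a (4 + t) w → ¬ A2-applies a (4 + t) w →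
    w (3 + t) ≤ a (3 + t) × (w (3 + t) ≡ a (3 + t) → w (2 + t) < a (2 + t))
  idle-bounds ¬r1 ¬r2 with m≤n⇒m<n∨m≡n top-bound
  ... | inj₂ full = <⇒≤ (top-full full) , λ e → ⊥-elim (<-irrefl e (top-full full))
  ... | inj₁ room with w (2 + t) ≟ 0
  ...   | yes v≡0 = ≮⇒≥ (λ over → ¬r1 (room , over , v≡0))
                  , λ _ → subst (_< _) (sym v≡0) (apos (2 + t) (s≤s z≤n))
  ...   | no v≢0 = <⇒≤ u<a , λ e → ⊥-elim (<-irrefl e u<a)
    where
    open CarriedDigit middle
    u≤2a : w (3 + t) ≤ 2 * a (3 + t)
    u≤2a = subst (w (3 + t) ≤_) (sym (double (a (3 + t))))
             (s≤s⁻¹ (≤∧≢⇒< bound (λ e → v≢0 (over⇒zero e))))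
    u<a : w (3 + t) < a (3 + t)
    u<a = ≰⇒> (λ a≤u → ¬r2 (room , a≤u , u≤2a , n≢0⇒n>0 v≢0))

  preserved : Invariant a s t (stepA a (4 + t) w)
  preserved with A1? a (4 + t) w
  ... | yes r1 = subst (Invariant a s t) (sym (stepA-A1 a (4 + t) w r1))
                   (ruleA1-keeps (CarriedDigit.bound middle))
  ... | no ¬r1 with A2? a (4 + t) w
  ...   | yes r2@(_ , a≤u , u≤2a , v>0) =
          subst (Invariant a s t) (sym (stepA-A2 a (4 + t) w ¬r1 r2))
            (ruleA2-keeps a≤u (subst (w (3 + t) ≤_) (double (a (3 + t))) u≤2a) v>0)
  ...   | no ¬r2 = subst (Invariant a s t) (sym (stepA-idle a (4 + t) w ¬r1 ¬r2))
                     (idle-keeps (proj₁ bounds) (proj₂ bounds))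
    where bounds = idle-bounds ¬r1 ¬r2

module Run (a : ℕ → ℕ) (apos : ∀ i → 1 ≤ i → 1 ≤ a i)
           (M N n : ℕ) (x y : Word)
           (rx : IsOstrowskiRep a M n x) (ry : IsOstrowskiRep a N n y) where

  s : Word
  s = sWord n x y

  s-inside : ∀ i → suc i ≤ n → s (suc i) ≡ x (suc i) + y (suc i)
  s-inside i = if-yes (suc i ≤? n)

  s-outside : ∀ i → ¬ suc i ≤ n → s (suc i) ≡ 0
  s-outside i = if-no (suc i ≤? n)

  sum-digits : ∀ t → DigitSum (a (2 + t)) (a (1 + t)) (s (2 + t)) (s (1 + t))
  sum-digits t with 2 + t ≤? n
  ... | yes in₂ = subst₂ (DigitSum (a (2 + t)) (a (1 + t)))
        (sym (s-inside (1 + t) in₂)) (sym (s-inside t in₁))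
        (digit-pair-sum (bx (2 + t) (s≤s z≤n) in₂) (by (2 + t) (s≤s z≤n) in₂)
          (zx (2 + t) (s≤s (s≤s z≤n)) in₂) (zy (2 + t) (s≤s (s≤s z≤n)) in₂)
          (bx (1 + t) (s≤s z≤n) in₁) (by (1 + t) (s≤s z≤n) in₁))
    where
    in₁ = ≤-trans (n≤1+n (1 + t)) in₂
    bx = proj₁ (proj₂ (proj₂ rx))
    by = proj₁ (proj₂ (proj₂ ry))
    zx = proj₂ (proj₂ (proj₂ rx))
    zy = proj₂ (proj₂ (proj₂ ry))
  ... | no out = subst (λ c → DigitSum (a (2 + t)) (a (1 + t)) c (s (1 + t)))
                   (sym (s-outside (1 + t) out))
                   (zero-digitSum (apos (2 + t) (s≤s z≤n)))

  -- The invariant for z_{m+1} = s, at k = m.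
  initial : ∀ t → 3 + t ≡ suc n → Invariant a s t s
  initial t k≡m = record
    { top-bound = subst (_≤ _) (sym s-top) z≤n
    ; top-full = λ e → ⊥-elim (<-irrefl (trans (sym s-top) e) (apos (3 + t) (s≤s z≤n)))
    ; middle = carried (sum-digits t) (inj₁ refl)
    ; low = inj₁ refl
    ; below = λ _ _ → refl }
    where
    s-top : s (3 + t) ≡ 0
    s-top = s-outside (2 + t) (<-irrefl (suc-injective k≡m))

  -- After j steps the algorithm has produced z_{m+1-j}, satisfying the invariant.
  invariant : ∀ j t → j + (3 + t) ≡ suc n → Invariant a s t (zIter a (suc n) s j)
  invariant zero t k≡m = initial t k≡m
  invariant (suc j) t eq =
    subst (λ k → Invariant a s t (step a k (zIter a (suc n) s j))) (sym k≡)
      (Step.preserved a apos s t (sum-digits t) (zIter a (suc n) s j) (invariant j (suc t) eq′))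
    where
    eq′ : j + (3 + suc t) ≡ suc n
    eq′ = trans (+-suc j (3 + t)) eq
    k≡ : suc n ∸ j ≡ 4 + t
    k≡ = trans (cong (_∸ j) (sym eq′)) (m+n∸m≡n j (4 + t))

mainTheorem6 : (a : ℕ → ℕ) → (∀ i → 1 ≤ i → 1 ≤ a i) →
    (M N n : ℕ) (x y : Word) →
    IsOstrowskiRep a M n x → IsOstrowskiRep a N n y →
    ∀ k → 3 ≤ k → k ≤ suc n →
      ((a (k ∸ 1) < z a n x y (suc k) (k ∸ 1) → z a n x y (suc k) k < a k)
      × (z a n x y (suc k) (k ∸ 1) ≡ a (k ∸ 1) → 0 < z a n x y (suc k) (k ∸ 2) →
         z a n x y (suc k) k < a k))
mainTheorem6 a apos M N n x y rx ry (suc (suc (suc t))) (s≤s (s≤s (s≤s z≤n))) k≤m =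
  (λ a<w → top-below (<⇒≤ a<w)) , (λ w≡a _ → top-below (≤-reflexive (sym w≡a)))
  where
  open Run a apos M N n x y rx ry
  steps : n ∸ (2 + t) + (3 + t) ≡ suc n
  steps = trans (+-suc (n ∸ (2 + t)) (2 + t)) (cong suc (m∸n+n≡m (s≤s⁻¹ k≤m)))
  open Invariant (invariant (n ∸ (2 + t)) t steps)
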